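{- Let $s > t \ge 1$ be integers and $n \in \mathbb{N}$. Then $n^{+}_{s,t} - n^{ - }_{s,t} - m_{s,t} = 0$ if $n$ is even and $s - t = p^2 - 1$ for some $p\in\mathbb{N}$, or if $n$ is odd and $s-t = p(p+1)-1$ for some $p \in \mathbb{N}$; in all other cases $n^{+}_{s,t} - n^{ - }_{s,t} - m_{s,t} > 0$.
   Context: $\mathbb{N} = \{0,1,2,\ldots\}$. Let $t_2(n) = \lfloor n^2/4\rfloor$. For $s>t\ge1$ let $m_{s,t} = \min\{m\in\mathbb{N} : (4s-4t-4m+n^2-4t_2(n))^{1/2} \in \mathbb{N}\}$, $R_3(n,s,t) = (4s-4t-4m_{s,t}+n^2-4t_2(n))^{1/2}$, $n^{+}_{s,t} = \frac12(n+R_3(n,s,t))$ and $n^{ - }_{s,t} = \frac12(n-R_3(n,s,t))$. -}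

module Defs where

open import Data.Nat as ℕ using (ℕ; _+_; _*_; _<_)
open import Data.Nat.DivMod using (_/_)
open import Data.Integer as ℤ using (ℤ; +_)
open import Data.Rational as ℚ using (ℚ)
open import Data.Product using (∃; _×_)
open import Data.Sum using (_⊎_)
open import Relation.Nullary using (¬_)
open import Relation.Binary.PropositionalEquality using (_≡_)

t₂ : ℕ → ℕ
t₂ n = (n * n) / 4

radicand : ℕ → ℕ → ℕ → ℕ → ℤ
radicand s t n m =
  ((((+ 4) ℤ.* (+ s) ℤ.- (+ 4) ℤ.* (+ t)) ℤ.- (+ 4) ℤ.* (+ m)) ℤ.+ (+ (n * n)))
    ℤ.- (+ 4) ℤ.* (+ t₂ n)

HasNatSqrt : ℕ → ℕ → ℕ → ℕ → Set
HasNatSqrt s t n m = ∃ λ (r : ℕ) → (+ r) ℤ.* (+ r) ≡ radicand s t n m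

IsMst : ℕ → ℕ → ℕ → ℕ → Set
IsMst s t n m = HasNatSqrt s t n m × (∀ k → k < m → ¬ HasNatSqrt s t n k)

nPlus : ℕ → ℕ → ℚ
nPlus n R = ((+ n) ℤ.+ (+ R)) ℚ./ 2

nMinus : ℕ → ℕ → ℚ
nMinus n R = ((+ n) ℤ.- (+ R)) ℚ./ 2

Even : ℕ → Set
Even n = ∃ λ k → n ≡ 2 * k

Odd : ℕ → Set
Odd n = ∃ λ k → n ≡ 2 * k + 1

-- the exceptional case: (n even and s − t = p² − 1) or (n odd and s − t = p(p+1) − 1),
-- written additively as s + 1 = t + (…)
ZeroCase : ℕ → ℕ → ℕ → Set
ZeroCase s t n =
  (Even n × ∃ λ p → s + 1 ≡ t + p * p) ⊎ (Odd n × ∃ λ p → s + 1 ≡ t + p * (p + 1))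

module Submission where

-- Write s = t + d and n = 2j + e with e ∈ {0, 1}, so that
-- n² = 4·t₂(n) + e.  Then "R² is the radicand for m" is the equation
-- R² + 4m = 4d + e in ℕ.  Such an R has the parity of e, R = 2q + e, and then
-- d = Q e q + m, where Q e q = q (q + e) runs through the squares (e = 0) or the
-- pronic numbers (e = 1).  Consecutive values satisfy Q e (q+1) = Q e q + R + 1,
-- so minimality of m forces m ≤ R: otherwise the root R + 2 would give a
-- smaller m.  Hence Q e q ≤ d < Q e (q+1), and as Q e is strictly increasing,
-- d + 1 is a value of Q e iff d + 1 = Q e (q+1) iff m = R.  Finally
-- n⁺ − n⁻ − m = R − m, and the exceptional case of the theorem says precisely
-- that d + 1 is a value of Q e.

open import Defs
open import Data.Nat using (ℕ; _<_; _≤_)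
open import Data.Integer using (+_)
open import Data.Rational using (ℚ; _-_; _/_; 0ℚ) renaming (_<_ to _<ℚ_)
open import Data.Product using (_×_)
open import Relation.Nullary using (¬_)
open import Relation.Binary.PropositionalEquality using (_≡_)

open import Data.Nat using (suc; zero; _+_; _*_; _∸_; NonZero; >-nonZero; z<s; s<s; s≤s)
open import Data.Nat.Properties
  using ( +-assoc; +-comm; *-comm; +-identityʳ; +-cancelˡ-≡; +-cancelʳ-≡
        ; *-cancelˡ-≡; +-monoˡ-≤; +-monoʳ-≤; +-monoˡ-<; *-mono-≤; *-mono-<
        ; ≤-refl; ≤-trans; ≤-antisym; <⇒≤; <⇒≱; ≰⇒>; ≮⇒≥; m≤m+n; m≤n+m
        ; 0≢1+n; 1+n≢0; m≤n⇒∃[o]m+o≡n; m<n⇒0<n∸m; m≤n⇒m<n∨m≡n )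
open import Data.Nat.DivMod
  using (_%_; m%n<n; m≡m%n+[m/n]*n; [m+kn]%n≡m%n; m<n⇒m%n≡m) renaming (_/_ to _div_)
import Data.Nat.Tactic.RingSolver as ℕ-Solver
import Data.Integer as ℤ
open import Data.Integer.Properties using (pos-+; pos-*; +-injective; +-inverseʳ; [+m]-[+n]≡m⊖n; ⊖-≥)
import Data.Integer.Tactic.RingSolver as ℤ-Solver
open import Data.Rational using (toℚᵘ) renaming (-_ to -ℚ_)
open import Data.Rational.Properties
  using (toℚᵘ-injective; toℚᵘ-fromℚᵘ; toℚᵘ-homo-+; toℚᵘ-homo‿-; positive⁻¹; normalize-pos)
import Data.Rational.Unnormalised as ℚᵘ
open import Data.Rational.Unnormalised using (mkℚᵘ; *≡*; _≃_)
open import Data.Rational.Unnormalised.Properties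
  using (≃-sym; +-cong; +-congˡ; +-congʳ; -‿cong; module ≃-Reasoning)
open import Data.Product using (∃; ∃₂; _,_; proj₁; proj₂)
open import Data.Sum using (inj₁; inj₂)
open import Data.Empty using (⊥-elim)
open import Function.Bundles using (_⇔_; mk⇔; Equivalence)
import Function.Properties.Equivalence as ⇔
open import Relation.Binary.PropositionalEquality
  using (refl; sym; trans; cong; cong₂; subst; subst₂; module ≡-Reasoning)

toℚᵘ-/ : ∀ i k → toℚᵘ (i / suc k) ≃ mkℚᵘ i k
toℚᵘ-/ i k = toℚᵘ-fromℚᵘ (mkℚᵘ i k)

toℚᵘ-homo-- : ∀ x y → toℚᵘ (x - y) ≃ toℚᵘ x ℚᵘ.- toℚᵘ y
toℚᵘ-homo-- x y = begin
    toℚᵘ (x - y)                          ≈⟨ toℚᵘ-homo-+ x (-ℚ y) ⟩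
    toℚᵘ x ℚᵘ.+ toℚᵘ (-ℚ y)  ≈⟨ +-congʳ (toℚᵘ x) (toℚᵘ-homo‿- y) ⟩
    toℚᵘ x ℚᵘ.- toℚᵘ y                    ∎
  where open ≃-Reasoning

difference-is-R-minus-m : ∀ n R m →
  (nPlus n R - nMinus n R) - ((+ m) / 1) ≡ ((+ R) ℤ.- (+ m)) / 1
difference-is-R-minus-m n R m = toℚᵘ-injective (begin
    toℚᵘ ((nPlus n R - nMinus n R) - (+ m) / 1)
      ≈⟨ toℚᵘ-homo-- (nPlus n R - nMinus n R) ((+ m) / 1) ⟩
    toℚᵘ (nPlus n R - nMinus n R) ℚᵘ.- toℚᵘ ((+ m) / 1)
      ≈⟨ +-cong (toℚᵘ-homo-- (nPlus n R) (nMinus n R)) (-‿cong (toℚᵘ-/ (+ m) 0)) ⟩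
    (toℚᵘ (nPlus n R) ℚᵘ.- toℚᵘ (nMinus n R)) ℚᵘ.- mkℚᵘ (+ m) 0
      ≈⟨ +-congˡ (ℚᵘ.- mkℚᵘ (+ m) 0) (+-cong (toℚᵘ-/ (+ n ℤ.+ + R) 1) (-‿cong (toℚᵘ-/ (+ n ℤ.- + R) 1))) ⟩
    (mkℚᵘ (+ n ℤ.+ + R) 1 ℚᵘ.- mkℚᵘ (+ n ℤ.- + R) 1) ℚᵘ.- mkℚᵘ (+ m) 0
      ≈⟨ *≡* (cross-multiplied (+ n) (+ R) (+ m)) ⟩
    mkℚᵘ (+ R ℤ.- + m) 0
      ≈⟨ ≃-sym (toℚᵘ-/ (+ R ℤ.- + m) 0) ⟩
    toℚᵘ (((+ R) ℤ.- (+ m)) / 1) ∎)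
  where
  open ≃-Reasoning
  cross-multiplied : ∀ n R m →
    (((n ℤ.+ R) ℤ.* + 2 ℤ.+ (ℤ.- (n ℤ.- R)) ℤ.* + 2) ℤ.* + 1 ℤ.+ (ℤ.- m) ℤ.* + 4) ℤ.* + 1
      ≡ (R ℤ.- m) ℤ.* + 4
  cross-multiplied = ℤ-Solver.solve-∀

positive-difference : ∀ R m → m < R → 0ℚ <ℚ ((+ R) ℤ.- (+ m)) / 1
positive-difference R m m<R =
  subst (λ x → 0ℚ <ℚ x / 1) (sym (trans ([+m]-[+n]≡m⊖n R m) (⊖-≥ (<⇒≤ m<R))))
    (positive⁻¹ _ {{normalize-pos (R ∸ m) 1 {{_}} {{>-nonZero (m<n⇒0<n∸m m<R)}}}})

R-minus-m-sign : ∀ {Z : Set} R m → m ≤ R → Z ⇔ (R ≡ m) →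
  (Z → ((+ R) ℤ.- (+ m)) / 1 ≡ 0ℚ) × (¬ Z → 0ℚ <ℚ ((+ R) ℤ.- (+ m)) / 1)
R-minus-m-sign {Z} R m m≤R Z⇔R≡m = vanishes , positive
  where
  open Equivalence Z⇔R≡m
  vanishes : Z → ((+ R) ℤ.- (+ m)) / 1 ≡ 0ℚ
  vanishes z with to z
  ... | refl = cong (_/ 1) (+-inverseʳ (+ m))
  positive : ¬ Z → 0ℚ <ℚ ((+ R) ℤ.- (+ m)) / 1
  positive ¬z with m≤n⇒m<n∨m≡n m≤R
  ... | inj₁ m<R  = positive-difference R m m<R
  ... | inj₂ refl = ⊥-elim (¬z (from refl))

divMod-unique : ∀ b .{{_ : NonZero b}} {x y e e′} → e < b → e′ < b →
  b * x + e ≡ b * y + e′ → e ≡ e′ × x ≡ y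
divMod-unique b {x} {y} {e} {e′} e<b e′<b eq = e≡e′ , x≡y
  where
  remainder : ∀ {z r} → r < b → (b * z + r) % b ≡ r
  remainder {z} {r} r<b = begin
    (b * z + r) % b  ≡⟨ cong (_% b) (trans (+-comm (b * z) r) (cong (λ w → r + w) (*-comm b z))) ⟩
    (r + z * b) % b  ≡⟨ [m+kn]%n≡m%n r z b ⟩
    r % b            ≡⟨ m<n⇒m%n≡m r<b ⟩
    r                ∎
    where open ≡-Reasoning
  e≡e′ : e ≡ e′
  e≡e′ = trans (sym (remainder e<b)) (trans (cong (_% b) eq) (remainder e′<b))
  x≡y : x ≡ y
  x≡y = *-cancelˡ-≡ x y b (+-cancelʳ-≡ e (b * x) (b * y)
          (subst (λ r → b * x + e ≡ b * y + r) (sym e≡e′) eq))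

bit<4 : ∀ {e} → e < 2 → e < 4
bit<4 e<2 = ≤-trans e<2 (m≤m+n 2 2)

euclid : ∀ n b .{{_ : NonZero b}} → n ≡ b * (n div b) + n % b
euclid n b = trans (m≡m%n+[m/n]*n n b) (trans (+-comm (n % b) _) (cong (_+ n % b) (*-comm (n div b) b)))

parity-split : ∀ n → ∃₂ λ j e → e < 2 × n ≡ 2 * j + e
parity-split n = n div 2 , n % 2 , m%n<n n 2 , euclid n 2

parity-unique : ∀ {n} j k {e e′} → e < 2 → e′ < 2 → n ≡ 2 * j + e → n ≡ 2 * k + e′ → e ≡ e′
parity-unique j k e<2 e′<2 n≡2j+e n≡2k+e′ =
  proj₁ (divMod-unique 2 {j} {k} e<2 e′<2 (trans (sym n≡2j+e) n≡2k+e′))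

Q : ℕ → ℕ → ℕ
Q e q = q * (q + e)

Q-step : ∀ e q → Q e (suc q) ≡ Q e q + (2 * q + e) + 1
Q-step e q = expand e q
  where
  expand : ∀ e q → suc q * (suc q + e) ≡ q * (q + e) + (2 * q + e) + 1
  expand = ℕ-Solver.solve-∀

square-Q : ∀ {e} → e < 2 → ∀ q → (2 * q + e) * (2 * q + e) ≡ 4 * Q e q + e
square-Q {zero}     _ q = even q
  where
  even : ∀ q → (2 * q + 0) * (2 * q + 0) ≡ 4 * (q * (q + 0)) + 0
  even = ℕ-Solver.solve-∀
square-Q {suc zero} _ q = odd q
  where
  odd : ∀ q → (2 * q + 1) * (2 * q + 1) ≡ 4 * (q * (q + 1)) + 1
  odd = ℕ-Solver.solve-∀
square-Q {suc (suc _)} (s<s (s<s ()))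

Q-mono-≤ : ∀ e {p p′} → p ≤ p′ → Q e p ≤ Q e p′
Q-mono-≤ e p≤p′ = *-mono-≤ p≤p′ (+-monoˡ-≤ e p≤p′)

Q-mono-< : ∀ e {p p′} → p < p′ → Q e p < Q e p′
Q-mono-< e p<p′ = *-mono-< p<p′ (+-monoˡ-< e p<p′)

Q-between : ∀ e q p → Q e q < Q e p → Q e p ≤ Q e (suc q) → p ≡ suc q
Q-between e q p lower upper = ≤-antisym p≤1+q 1+q≤p
  where
  1+q≤p : suc q ≤ p
  1+q≤p = ≰⇒> (λ p≤q → <⇒≱ lower (Q-mono-≤ e p≤q))
  p≤1+q : p ≤ suc q
  p≤1+q = ≮⇒≥ (λ 1+q<p → <⇒≱ (Q-mono-< e 1+q<p) upper)

square-t₂ : ∀ {n} j {e} → e < 2 → n ≡ 2 * j + e → n * n ≡ 4 * t₂ n + e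
square-t₂ {n} j {e} e<2 refl = trans (square-Q e<2 j) (cong (λ x → 4 * x + e) (sym t₂≡Q))
  where
  division : 4 * t₂ n + (n * n) % 4 ≡ 4 * Q e j + e
  division = trans (sym (euclid (n * n) 4)) (square-Q e<2 j)
  t₂≡Q : t₂ n ≡ Q e j
  t₂≡Q = proj₂ (divMod-unique 4 (m%n<n (n * n) 4) (bit<4 e<2) division)

radicand-reduced : ∀ t d n k e → n * n ≡ 4 * t₂ n + e →
  radicand (t + d) t n k ≡ + (4 * d + e) ℤ.- + (4 * k)
radicand-reduced t d n k e n²≡ = begin
  radicand (t + d) t n k
    ≡⟨ cong₂ (λ a b → (((+ 4 ℤ.* a ℤ.- + 4 ℤ.* + t) ℤ.- + 4 ℤ.* + k) ℤ.+ b) ℤ.- + 4 ℤ.* + T)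
             (pos-+ t d) (trans (cong +_ n²≡) (cast (t₂ n))) ⟩
  (((+ 4 ℤ.* (+ t ℤ.+ + d) ℤ.- + 4 ℤ.* + t) ℤ.- + 4 ℤ.* + k) ℤ.+ (+ 4 ℤ.* + T ℤ.+ + e)) ℤ.- + 4 ℤ.* + T
    ≡⟨ regroup (+ t) (+ d) (+ k) (+ T) (+ e) ⟩
  (+ 4 ℤ.* + d ℤ.+ + e) ℤ.- + 4 ℤ.* + k
    ≡⟨ sym (cong₂ ℤ._-_ (cast d) (pos-* 4 k)) ⟩
  + (4 * d + e) ℤ.- + (4 * k) ∎
  where
  open ≡-Reasoning
  T : ℕ
  T = t₂ n
  cast : ∀ x → + (4 * x + e) ≡ + 4 ℤ.* + x ℤ.+ + e
  cast x = trans (pos-+ (4 * x) e) (cong (ℤ._+ + e) (pos-* 4 x))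
  regroup : ∀ t d k T e →
    (((+ 4 ℤ.* (t ℤ.+ d) ℤ.- + 4 ℤ.* t) ℤ.- + 4 ℤ.* k) ℤ.+ (+ 4 ℤ.* T ℤ.+ e)) ℤ.- + 4 ℤ.* T
      ≡ (+ 4 ℤ.* d ℤ.+ e) ℤ.- + 4 ℤ.* k
  regroup = ℤ-Solver.solve-∀

square-eq-difference : ∀ r a b → ((+ r) ℤ.* (+ r) ≡ + a ℤ.- + b) ⇔ (r * r + b ≡ a)
square-eq-difference r a b = mk⇔ to from
  where
  cancel : ∀ x y → x ℤ.- y ℤ.+ y ≡ x
  cancel = ℤ-Solver.solve-∀
  uncancel : ∀ x y → x ≡ x ℤ.+ y ℤ.- y
  uncancel = ℤ-Solver.solve-∀
  to : (+ r) ℤ.* (+ r) ≡ + a ℤ.- + b → r * r + b ≡ a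
  to eq = +-injective (begin
    + (r * r + b)              ≡⟨ pos-+ (r * r) b ⟩
    + (r * r) ℤ.+ + b          ≡⟨ cong (ℤ._+ + b) (trans (pos-* r r) eq) ⟩
    + a ℤ.- + b ℤ.+ + b        ≡⟨ cancel (+ a) (+ b) ⟩
    + a                        ∎)
    where open ≡-Reasoning
  from : r * r + b ≡ a → (+ r) ℤ.* (+ r) ≡ + a ℤ.- + b
  from refl = begin
    (+ r) ℤ.* (+ r)            ≡⟨ uncancel (+ r ℤ.* + r) (+ b) ⟩
    + r ℤ.* + r ℤ.+ + b ℤ.- + b ≡⟨ cong (ℤ._- + b) (sym (trans (pos-+ (r * r) b) (cong (ℤ._+ + b) (pos-* r r)))) ⟩
    + (r * r + b) ℤ.- + b      ∎
    where open ≡-Reasoning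

IsRoot : ℕ → ℕ → ℕ → ℕ → Set
IsRoot e d k r = r * r + 4 * k ≡ 4 * d + e

root-iff : ∀ t d n k e r → n * n ≡ 4 * t₂ n + e →
  ((+ r) ℤ.* (+ r) ≡ radicand (t + d) t n k) ⇔ IsRoot e d k r
root-iff t d n k e r n²≡ =
  subst (λ x → ((+ r) ℤ.* (+ r) ≡ x) ⇔ IsRoot e d k r) (sym (radicand-reduced t d n k e n²≡))
    (square-eq-difference r (4 * d + e) (4 * k))

shift-t : ∀ t d x → (t + d + 1 ≡ t + x) ⇔ (d + 1 ≡ x)
shift-t t d x = mk⇔ (λ eq → +-cancelˡ-≡ t (d + 1) x (trans (sym (+-assoc t d 1)) eq))
                    (λ eq → trans (+-assoc t d 1) (cong (λ y → t + y) eq))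

zeroCase-iff : ∀ t d n j e → e < 2 → n ≡ 2 * j + e →
  ZeroCase (t + d) t n ⇔ (∃ λ p → d + 1 ≡ Q e p)
zeroCase-iff t d n j zero _ n≡2j = mk⇔ to from
  where
  square : ∀ p → p * p ≡ Q 0 p
  square p = cong (λ y → p * y) (sym (+-identityʳ p))
  to : ZeroCase (t + d) t n → ∃ λ p → d + 1 ≡ Q 0 p
  to (inj₁ (_ , p , eq))         = p , trans (Equivalence.to (shift-t t d (p * p)) eq) (square p)
  to (inj₂ ((k , n≡2k+1) , _)) = ⊥-elim (0≢1+n (parity-unique j k z<s ≤-refl n≡2j n≡2k+1))
  from : (∃ λ p → d + 1 ≡ Q 0 p) → ZeroCase (t + d) t n
  from (p , eq) = inj₁ ((j , trans n≡2j (+-identityʳ (2 * j))) ,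
                        p , Equivalence.from (shift-t t d (p * p)) (trans eq (sym (square p))))
zeroCase-iff t d n j (suc zero) _ n≡2j+1 = mk⇔ to from
  where
  to : ZeroCase (t + d) t n → ∃ λ p → d + 1 ≡ Q 1 p
  to (inj₂ (_ , p , eq))      = p , Equivalence.to (shift-t t d (Q 1 p)) eq
  to (inj₁ ((k , n≡2k) , _)) =
    ⊥-elim (1+n≢0 (parity-unique j k ≤-refl z<s n≡2j+1 (trans n≡2k (sym (+-identityʳ (2 * k))))))
  from : (∃ λ p → d + 1 ≡ Q 1 p) → ZeroCase (t + d) t n
  from (p , eq) = inj₂ ((j , n≡2j+1) , p , Equivalence.from (shift-t t d (Q 1 p)) eq)
zeroCase-iff t d n j (suc (suc _)) (s<s (s<s ())) _

Minimal : ℕ → ℕ → ℕ → Set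
Minimal e d m = ∀ k → k < m → ∀ r → ¬ IsRoot e d k r

shape-root : ∀ {e} q k → e < 2 → IsRoot e (Q e q + k) k (2 * q + e)
shape-root {e} q k e<2 = trans (cong (_+ 4 * k) (square-Q e<2 q)) (regroup (Q e q) k e)
  where
  regroup : ∀ a k e → 4 * a + e + 4 * k ≡ 4 * (a + k) + e
  regroup = ℕ-Solver.solve-∀

root-shape : ∀ {e} d k r → e < 2 → IsRoot e d k r → ∃ λ q → r ≡ 2 * q + e × d ≡ Q e q + k
root-shape {e} d k r e<2 root with parity-split r
... | q , e′ , e′<2 , refl
    with divMod-unique 4 {Q e′ q + k} {d} (bit<4 e′<2) (bit<4 e<2) (trans (sym (shape-root q k e′<2)) root)
...    | refl , Qq+k≡d = q , refl , sym Qq+k≡d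

-- Minimality forces m ≤ R: if R < m, the next root R + 2 would serve the
-- smaller offset m − (R + 1), because Q e (q + 1) − Q e q = R + 1.
root-bound : ∀ {e} d m R → e < 2 → IsRoot e d m R → Minimal e d m → m ≤ R
root-bound {e} d m R e<2 root minimal with root-shape d m R e<2 root
... | q , refl , refl = ≮⇒≥ R≮m
  where
  R≮m : ¬ (2 * q + e < m)
  R≮m R<m with m≤n⇒∃[o]m+o≡n R<m
  ... | k , refl = minimal k (s≤s (m≤n+m k (2 * q + e))) (2 * suc q + e)
                     (subst (λ x → IsRoot e x k (2 * suc q + e)) gap (shape-root (suc q) k e<2))
    where
    gap : Q e (suc q) + k ≡ Q e q + (suc (2 * q + e) + k)
    gap = trans (cong (_+ k) (Q-step e q)) (regroup (Q e q) (2 * q + e) k)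
      where
      regroup : ∀ a b k → a + b + 1 + k ≡ a + (suc b + k)
      regroup = ℕ-Solver.solve-∀

-- With m minimal, d + 1 is a value of Q e exactly when m = R: the root gives
-- Q e q ≤ d < Q e (q + 1), and Q e (q + 1) = d + 1 means m = R.
exceptional-iff : ∀ {e} d m R → e < 2 → IsRoot e d m R → Minimal e d m →
  (∃ λ p → d + 1 ≡ Q e p) ⇔ (R ≡ m)
exceptional-iff {e} d m R e<2 root minimal
  with root-bound d m R e<2 root minimal | root-shape d m R e<2 root
... | m≤R | q , refl , refl = mk⇔ to from
  where
  to : (∃ λ p → Q e q + m + 1 ≡ Q e p) → 2 * q + e ≡ m
  to (p , eq) with Q-between e q p lower upper
    where
    lower : Q e q < Q e p
    lower = subst (Q e q <_) (trans (+-comm 1 (Q e q + m)) eq) (s≤s (m≤m+n (Q e q) m))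
    upper : Q e p ≤ Q e (suc q)
    upper = subst₂ _≤_ eq (sym (Q-step e q)) (+-monoˡ-≤ 1 (+-monoʳ-≤ (Q e q) m≤R))
  ... | refl = sym (+-cancelˡ-≡ (Q e q) m (2 * q + e) (+-cancelʳ-≡ 1 (Q e q + m) (Q e q + (2 * q + e))
                   (trans eq (Q-step e q))))
  from : 2 * q + e ≡ m → ∃ λ p → Q e q + m + 1 ≡ Q e p
  from refl = suc q , sym (Q-step e q)

lemma2p9 : (s t n : ℕ) → 1 ≤ t → t < s →
    (m : ℕ) → IsMst s t n m →
    (R : ℕ) → (+ R) Data.Integer.* (+ R) ≡ radicand s t n m →
    (ZeroCase s t n → (nPlus n R - nMinus n R) - ((+ m) / 1) ≡ 0ℚ) ×
    (¬ ZeroCase s t n → 0ℚ <ℚ (nPlus n R - nMinus n R) - ((+ m) / 1))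
lemma2p9 s t n _ t<s m (_ , minimal) R hR with m≤n⇒∃[o]m+o≡n (<⇒≤ t<s) | parity-split n
... | d , refl | j , e , e<2 , n≡2j+e rewrite difference-is-R-minus-m n R m =
  R-minus-m-sign R m (root-bound d m R e<2 root minimalℕ)
    (⇔.trans (zeroCase-iff t d n j e e<2 n≡2j+e) (exceptional-iff d m R e<2 root minimalℕ))
  where
  n²≡ : n * n ≡ 4 * t₂ n + e
  n²≡ = square-t₂ j e<2 n≡2j+e
  root : IsRoot e d m R
  root = Equivalence.to (root-iff t d n m e R n²≡) hR
  minimalℕ : Minimal e d m
  minimalℕ k k<m r isRoot = minimal k k<m (r , Equivalence.from (root-iff t d n k e r n²≡) isRoot)
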